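{- Fix a skew shape $\lambda/\mu$ and sequences $w$, $h$, $\alpha$. Then there exists at most one SVRPP $T$ of shape $\lambda/\mu$ with $\mathrm{read}(T)=w$, $\mathrm{height}(T)=h$ and $\mathrm{ex}(T)=\alpha$.
   Context: Boxes are $(a,b)$ (row $a$, column $b$); $\lambda/\mu$ is a skew diagram. An SVRPP of shape $\lambda/\mu$ is a filling $T$ by nonempty finite sets $T(a,b)$ of positive integers weakly increasing along rows and down columns ($A\le B$ meaning $\max A\le\min B$). $\mathrm{ex}(T)=(e_1,e_2,\ldots)$, $e_a=\sum_{(a,b)\in\lambda/\mu}(|T(a,b)|-1)$. Reading word: the pivot of a box is the minimum of its set; $\mathrm{read}(T)=w^{(N)}\cdots w^{(1)}$ ($N$ the number of rows, rows read bottom to top), where $w^{(a)}$ lists first all non-pivot entries of row $a$, boxes from right to left and within each box from largest to smallest, then the pivots of row $a$ from left to right, omitting the pivot of $(a,b)$ whenever $(a-1,b)\in\lambda/\mu$ and the pivot equals $\max T(a-1,b)$. If $\mathrm{read}(T)=w_1\cdots w_m$, the height vector is $\mathrm{height}(T)=(h_1,\ldots,h_m)$ where $h_k$ is the row of $T$ from which the letter $w_k$ was read. -}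

module Defs where

open import Data.Nat using (ℕ; zero; suc; _+_; _∸_; _≤_; _<_; _≥_; _⊔_; _≟_; _<?_; _≤?_)
open import Data.Bool using (Bool; true; false; not; _∧_; if_then_else_)
open import Data.List using (List; []; _∷_; _++_; map; concatMap; reverse; upTo; drop; length; foldr)
open import Data.Nat.ListAction using (sum)
open import Data.List.Relation.Unary.All using (All)
open import Data.List.Relation.Unary.Linked using (Linked)
open import Data.Product using (_×_; _,_)
open import Relation.Nullary using (Dec; ¬_)
open import Relation.Nullary.Decidable using (⌊_⌋; _×-dec_)
open import Relation.Binary.PropositionalEquality using (_≡_)

-- A partition / shape is a list of row lengths (row a, 1-indexed, has length `part lam a`).
part : List ℕ → ℕ → ℕ
part l zero = 0
part [] (suc a) = 0
part (x ∷ l) (suc zero) = x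
part (x ∷ l) (suc (suc a)) = part l (suc a)

IsPartition : List ℕ → Set
IsPartition l = Linked _≥_ l

Contained : List ℕ → List ℕ → Set
Contained mu lam = ∀ a → part mu a ≤ part lam a

-- box (a,b) lies in λ/μ  (rows and columns 1-indexed)
InShape : List ℕ → List ℕ → ℕ → ℕ → Set
InShape lam mu a b = part mu a < b × b ≤ part lam a

inShape? : ∀ lam mu a b → Dec (InShape lam mu a b)
inShape? lam mu a b = (part mu a <? b) ×-dec (b ≤? part lam a)

-- A finite set of positive integers is represented canonically by the
-- strictly increasing list of its elements.
Filling : Set
Filling = ℕ → ℕ → List ℕ

minS : List ℕ → ℕ          -- minimum of a (strictly increasing) nonempty list = its head
minS [] = 0
minS (x ∷ _) = x

maxS : List ℕ → ℕ
maxS = foldr _⊔_ 0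

NonEmpty : List ℕ → Set
NonEmpty xs = ¬ (xs ≡ [])

record SVRPP (lam mu : List ℕ) (T : Filling) : Set where
  field
    nonempty : ∀ a b → InShape lam mu a b → NonEmpty (T a b)
    sorted   : ∀ a b → InShape lam mu a b → Linked _<_ (T a b)
    positive : ∀ a b → InShape lam mu a b → All (1 ≤_) (T a b)
    rowWeak  : ∀ a b → InShape lam mu a b → InShape lam mu a (suc b) →
               maxS (T a b) ≤ minS (T a (suc b))
    colWeak  : ∀ a b → InShape lam mu a b → InShape lam mu (suc a) b →
               maxS (T a b) ≤ minS (T (suc a) b)

range : ℕ → ℕ → List ℕ
range m n = map (λ i → suc m + i) (upTo (n ∸ m))

rowWord : List ℕ → List ℕ → Filling → ℕ → List (ℕ × ℕ)
rowWord lam mu T a = map (λ x → x , a) (nonPivots ++ pivots)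
  where
  cols : List ℕ
  cols = range (part mu a) (part lam a)
  nonPivots : List ℕ
  nonPivots = concatMap (λ b → reverse (drop 1 (T a b))) (reverse cols)
  omit : ℕ → Bool
  omit b = ⌊ inShape? lam mu (a ∸ 1) b ⌋ ∧ ⌊ minS (T a b) ≟ maxS (T (a ∸ 1) b) ⌋
  pivots : List ℕ
  pivots = concatMap (λ b → if omit b then [] else minS (T a b) ∷ []) cols

readH : List ℕ → List ℕ → Filling → List (ℕ × ℕ)
readH lam mu T = concatMap (rowWord lam mu T) (reverse (range 0 (length lam)))

read : List ℕ → List ℕ → Filling → List ℕ
read lam mu T = map Data.Product.proj₁ (readH lam mu T)

height : List ℕ → List ℕ → Filling → List ℕ
height lam mu T = map Data.Product.proj₂ (readH lam mu T)

ex : List ℕ → List ℕ → Filling → ℕ → ℕ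
ex lam mu T a = sum (map (λ b → length (T a b) ∸ 1) (range (part mu a) (part lam a)))

module Submission where

-- The letters of the reading word carry their rows, so the word determines every row word, and T
-- is recovered row by row from the top. A row word lists the e_a non-pivot entries and then the
-- pivots, so ex cuts it into these two parts. Along a row the pivots increase weakly, and a pivot
-- is omitted exactly when it equals the maximum of the box above (known by induction), the least
-- value it may take; two such rows with the same pivot word must have the same pivots, since a row
-- that omits where the other emits falls behind and can never catch up. Finally the non-pivot
-- entries of a box lie strictly above its pivot and weakly below the next pivot, so the pivots cut
-- the non-pivot word into the boxes.

open import Defs
open import Data.Bool using (_∧_; if_then_else_)
open import Data.Empty using (⊥-elim)
open import Data.List using (List; []; _∷_; _++_; _∷ʳ_; [_]; map; concatMap; reverse; drop; length; upTo)
open import Data.List.Properties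
  using (∷-injectiveˡ; ∷-injectiveʳ; ++-assoc; ++-identityʳ; ++-cancelʳ; ++-conicalˡ; concatMap-++; concatMap-cong;
         unfold-reverse; reverse-++; reverse-injective; reverse-map; reverse-upTo; length-++; length-reverse;
         length-drop; map-cong; map-injective)
open import Data.List.Membership.Propositional using (_∈_)
open import Data.List.Membership.Propositional.Properties using (∈-map⁺; ∈-map⁻; ∈-upTo⁺; ∈-upTo⁻)
open import Data.List.Relation.Unary.All as All using (All; []; _∷_)
import Data.List.Relation.Unary.All.Properties as Allₚ
open import Data.List.Relation.Unary.AllPairs as AllPairs using (AllPairs; []; _∷_)
import Data.List.Relation.Unary.AllPairs.Properties as AllPairsₚ
open import Data.List.Relation.Unary.Any.Properties using (reverse⁺)
open import Data.List.Relation.Unary.Linked using (Linked; []; [-]; _∷_)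
open import Data.List.Relation.Unary.Linked.Properties using (Linked⇒All)
open import Data.List.Relation.Unary.Unique.Propositional using (Unique)
import Data.List.Relation.Unary.Unique.Propositional.Properties as Uniqueₚ
open import Data.Nat using (ℕ; zero; suc; _+_; _∸_; _≤_; _<_; _≟_; z≤n; s≤s)
open import Data.Nat.Properties
open import Data.Nat.ListAction using (sum)
open import Data.Product using (_×_; _,_; proj₁; proj₂)
open import Data.Sum using (inj₁; inj₂)
open import Function using (id; _∘_; _on_)
open import Level using (0ℓ)
open import Relation.Nullary using (Dec; yes; no; ¬_)
open import Relation.Nullary.Decidable using (⌊_⌋)
open import Relation.Unary using (Pred; Decidable)
open import Relation.Binary.PropositionalEquality hiding ([_])

++-injective-length : ∀ {A : Set} (xs xs′ : List A) {ys ys′ : List A} →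
  length xs ≡ length xs′ → xs ++ ys ≡ xs′ ++ ys′ → xs ≡ xs′ × ys ≡ ys′
++-injective-length []       []         _   eq = refl , eq
++-injective-length (x ∷ xs) (x′ ∷ xs′) len eq =
  let xs≡xs′ , ys≡ys′ = ++-injective-length xs xs′ (suc-injective len) (∷-injectiveʳ eq)
  in cong₂ _∷_ (∷-injectiveˡ eq) xs≡xs′ , ys≡ys′

++-injective-boundary : ∀ {A : Set} (Q : A → Set) {xs xs′ ys ys′ : List A} →
  All Q xs → All Q xs′ → All (¬_ ∘ Q) ys → All (¬_ ∘ Q) ys′ →
  xs ++ ys ≡ xs′ ++ ys′ → xs ≡ xs′ × ys ≡ ys′
++-injective-boundary Q [] [] _ _ eq = refl , eq
++-injective-boundary Q [] (_ ∷ _) [] _ ()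
++-injective-boundary Q [] (q ∷ _) (¬q ∷ _) _ eq = ⊥-elim (¬q (subst Q (sym (∷-injectiveˡ eq)) q))
++-injective-boundary Q (_ ∷ _) [] _ [] ()
++-injective-boundary Q (q ∷ _) [] _ (¬q ∷ _) eq = ⊥-elim (¬q (subst Q (∷-injectiveˡ eq) q))
++-injective-boundary Q (_ ∷ qs) (_ ∷ qs′) ¬qs ¬qs′ eq =
  let xs≡xs′ , ys≡ys′ = ++-injective-boundary Q qs qs′ ¬qs ¬qs′ (∷-injectiveʳ eq)
  in cong₂ _∷_ (∷-injectiveˡ eq) xs≡xs′ , ys≡ys′

∷ʳ-≢-[] : ∀ {A : Set} (xs : List A) {x : A} → xs ∷ʳ x ≢ []
∷ʳ-≢-[] []      ()
∷ʳ-≢-[] (_ ∷ _) ()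

map-proj-injective : ∀ {A B : Set} {xs ys : List (A × B)} →
  map proj₁ xs ≡ map proj₁ ys → map proj₂ xs ≡ map proj₂ ys → xs ≡ ys
map-proj-injective {xs = []}    {[]}    _  _  = refl
map-proj-injective {xs = _ ∷ _} {_ ∷ _} e₁ e₂ =
  cong₂ _∷_ (cong₂ _,_ (∷-injectiveˡ e₁) (∷-injectiveˡ e₂))
            (map-proj-injective (∷-injectiveʳ e₁) (∷-injectiveʳ e₂))

concatMap-reverse : ∀ {A B : Set} (f : A → List B) (xs : List A) →
  concatMap (reverse ∘ f) (reverse xs) ≡ reverse (concatMap f xs)
concatMap-reverse f []       = refl
concatMap-reverse f (x ∷ xs) = begin
  concatMap (reverse ∘ f) (reverse (x ∷ xs))                  ≡⟨ cong (concatMap (reverse ∘ f)) (unfold-reverse x xs) ⟩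
  concatMap (reverse ∘ f) (reverse xs ∷ʳ x)                   ≡⟨ concatMap-++ (reverse ∘ f) (reverse xs) [ x ] ⟩
  concatMap (reverse ∘ f) (reverse xs) ++ reverse (f x) ++ [] ≡⟨ cong₂ _++_ (concatMap-reverse f xs) (++-identityʳ _) ⟩
  reverse (concatMap f xs) ++ reverse (f x)                   ≡⟨ reverse-++ (f x) (concatMap f xs) ⟨
  reverse (f x ++ concatMap f xs)                             ∎
  where open ≡-Reasoning

length-concatMap : ∀ {A B : Set} (f : A → List B) (xs : List A) →
  length (concatMap f xs) ≡ sum (map (length ∘ f) xs)
length-concatMap f []       = refl
length-concatMap f (x ∷ xs) = trans (length-++ (f x)) (cong (length (f x) +_) (length-concatMap f xs))

Tagged : ∀ {A : Set} → (ℕ → List (A × ℕ)) → Set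
Tagged f = ∀ r → All ((_≡ r) ∘ proj₂) (f r)

concatMap-injective-tagged : ∀ {A : Set} {f g : ℕ → List (A × ℕ)} → Tagged f → Tagged g →
  ∀ {rs} → Unique rs → concatMap f rs ≡ concatMap g rs → All (λ r → f r ≡ g r) rs
concatMap-injective-tagged tf tg []              _  = []
concatMap-injective-tagged tf tg {r ∷ _} (r∉rs ∷ u) eq =
  let fr≡gr , rest≡ = ++-injective-boundary ((_≡ r) ∘ proj₂) (tf r) (tg r) (untagged tf r∉rs) (untagged tg r∉rs) eq
  in fr≡gr ∷ concatMap-injective-tagged tf tg u rest≡
  where
  untagged : ∀ {h} → Tagged h → ∀ {rs} → All (r ≢_) rs → All (λ z → ¬ proj₂ z ≡ r) (concatMap h rs)
  untagged th []                      = []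
  untagged th {r′ ∷ _} (r≢r′ ∷ r∉rs) =
    Allₚ.++⁺ (All.map (λ z≡r′ z≡r → r≢r′ (trans (sym z≡r) z≡r′)) (th r′)) (untagged th r∉rs)

∈-range⁺ : ∀ {m n b} → m < b → b ≤ n → b ∈ range m n
∈-range⁺ {m} {n} {suc b} (s≤s m≤b) b<n =
  subst (_∈ range m n) (m+[n∸m]≡n (s≤s m≤b)) (∈-map⁺ (suc m +_) (∈-upTo⁺ (∸-monoˡ-< b<n m≤b)))

∈-range⁻ : ∀ {m n b} → b ∈ range m n → m < b × b ≤ n
∈-range⁻ {m} {n} b∈ with i , i∈ , refl ← ∈-map⁻ (suc m +_) b∈ = s≤s (m≤m+n m i) , offset≤ i (∈-upTo⁻ i∈)
  where
  offset≤ : ∀ i → i < n ∸ m → suc m + i ≤ n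
  offset≤ i i<n∸m = subst (_≤ n) (cong suc (+-comm i m))
    (m≤o∸n⇒m+n≤o (suc i) (<⇒≤ (m∸n≢0⇒n<m (>⇒≢ (≤-trans (s≤s z≤n) i<n∸m)))) i<n∸m)

AllPairs-range : ∀ {R : ℕ → ℕ → Set} {m n} →
  (∀ {b d} → b ∈ range m n → d ∈ range m n → b < d → R b d) → AllPairs R (range m n)
AllPairs-range {m = m} {n} R-in = AllPairsₚ.map⁺ (AllPairsₚ.applyUpTo⁺₁ id (n ∸ m) λ i<j j<k →
  R-in (∈-map⁺ (suc m +_) (∈-upTo⁺ (<-trans i<j j<k))) (∈-map⁺ (suc m +_) (∈-upTo⁺ j<k)) (+-monoʳ-< (suc m) i<j))

reverse-range-unique : ∀ n → Unique (reverse (range 0 n))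
reverse-range-unique n = subst Unique (trans (cong (map suc) (sym (reverse-upTo n))) (reverse-map suc (upTo n)))
  (Uniqueₚ.map⁺ suc-injective (Uniqueₚ.downFrom⁺ n))

minS≤maxS : ∀ xs → minS xs ≤ maxS xs
minS≤maxS []       = z≤n
minS≤maxS (x ∷ xs) = m≤m⊔n x (maxS xs)

xs≤maxS : ∀ xs → All (_≤ maxS xs) xs
xs≤maxS []       = []
xs≤maxS (x ∷ xs) = m≤m⊔n x _ ∷ All.map (λ y≤ → ≤-trans y≤ (m≤n⊔m x _)) (xs≤maxS xs)

minS<drop1 : ∀ {xs} → Linked _<_ xs → All (minS xs <_) (drop 1 xs)
minS<drop1 []        = []
minS<drop1 [-]       = []
minS<drop1 (x<y ∷ l) = Linked⇒All <-trans x<y l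

minS-drop1-injective : ∀ {xs ys} → NonEmpty xs → NonEmpty ys →
  minS xs ≡ minS ys → drop 1 xs ≡ drop 1 ys → xs ≡ ys
minS-drop1-injective {[]}            ne _  _    _      = ⊥-elim (ne refl)
minS-drop1-injective {_ ∷ _} {[]}    _  ne _    _      = ⊥-elim (ne refl)
minS-drop1-injective {_ ∷ _} {_ ∷ _} _  _  min≡ drop1≡ = cong₂ _∷_ min≡ drop1≡

record SortedBlocks (s : ℕ → List ℕ) (cs : List ℕ) : Set where
  constructor sortedBlocks
  field
    nonempty : All (NonEmpty ∘ s) cs
    strict   : All (Linked _<_ ∘ s) cs
    ordered  : AllPairs (λ b d → maxS (s b) ≤ minS (s d)) cs

module _ {s : ℕ → List ℕ} where

  SortedBlocks-tail : ∀ {c cs} → SortedBlocks s (c ∷ cs) → SortedBlocks s cs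
  SortedBlocks-tail (sortedBlocks (_ ∷ ne) (_ ∷ st) (_ ∷ ord)) = sortedBlocks ne st ord

  minS-ascending : ∀ {cs} → SortedBlocks s cs → AllPairs (_≤_ on (minS ∘ s)) cs
  minS-ascending B = AllPairs.map (λ {b} → ≤-trans (minS≤maxS (s b))) (SortedBlocks.ordered B)

  tails-above : ∀ {d cs} → SortedBlocks s (d ∷ cs) → All (minS (s d) <_) (concatMap (drop 1 ∘ s) (d ∷ cs))
  tails-above B@(sortedBlocks _ (d-strict ∷ strict) _) =
    Allₚ.++⁺ (minS<drop1 d-strict) (Allₚ.concat⁺ (Allₚ.map⁺ (All.zipWith
      (λ (d≤e , e-strict) → All.map (≤-<-trans d≤e) (minS<drop1 e-strict))
      (AllPairs.head (minS-ascending B) , strict))))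

  next-minS-separates : ∀ {c d cs} → SortedBlocks s (c ∷ d ∷ cs) →
    All (_≤ minS (s d)) (drop 1 (s c)) × All (λ x → ¬ x ≤ minS (s d)) (concatMap (drop 1 ∘ s) (d ∷ cs))
  next-minS-separates {c} B@(sortedBlocks _ _ ((c≤d ∷ _) ∷ _)) =
    All.map (λ x≤ → ≤-trans x≤ c≤d) (Allₚ.drop⁺ 1 (xs≤maxS (s c))) ,
    All.map <⇒≱ (tails-above (SortedBlocks-tail B))

first-tails-split : ∀ {s s′ c cs} → SortedBlocks s (c ∷ cs) → SortedBlocks s′ (c ∷ cs) →
  All (λ b → minS (s b) ≡ minS (s′ b)) cs →
  drop 1 (s c) ++ concatMap (drop 1 ∘ s) cs ≡ drop 1 (s′ c) ++ concatMap (drop 1 ∘ s′) cs →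
  drop 1 (s c) ≡ drop 1 (s′ c) × concatMap (drop 1 ∘ s) cs ≡ concatMap (drop 1 ∘ s′) cs
first-tails-split {cs = []} _ _ _ eq = ++-cancelʳ [] _ _ eq , refl
first-tails-split {s} {s′} {c} {d ∷ cs} B B′ (d≡ ∷ _) eq =
  let below  , above  = next-minS-separates B
      below′ , above′ = subst (λ t → All (_≤ t) (drop 1 (s′ c)) ×
                                     All (λ x → ¬ x ≤ t) (concatMap (drop 1 ∘ s′) (d ∷ cs)))
                              (sym d≡) (next-minS-separates B′)
  in ++-injective-boundary (_≤ minS (s d)) below below′ above above′ eq

blocks-injective : ∀ {s s′ cs} → SortedBlocks s cs → SortedBlocks s′ cs →
  All (λ b → minS (s b) ≡ minS (s′ b)) cs →
  concatMap (drop 1 ∘ s) cs ≡ concatMap (drop 1 ∘ s′) cs → All (λ b → s b ≡ s′ b) cs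
blocks-injective {cs = []} _ _ _ _ = []
blocks-injective {cs = c ∷ cs} B B′ (c≡ ∷ cs≡) eq =
  let c-tails≡ , cs-tails≡ = first-tails-split B B′ cs≡ eq
  in minS-drop1-injective (All.head (SortedBlocks.nonempty B)) (All.head (SortedBlocks.nonempty B′)) c≡ c-tails≡
     ∷ blocks-injective (SortedBlocks-tail B) (SortedBlocks-tail B′) cs≡ cs-tails≡

module Pivots {above : Pred ℕ 0ℓ} (above? : Decidable above) (M : ℕ → ℕ) where

  pivot : ℕ → ℕ → List ℕ
  pivot b x = if ⌊ above? b ⌋ ∧ ⌊ x ≟ M b ⌋ then [] else [ x ]

  pivots : (ℕ → ℕ) → List ℕ → List ℕ
  pivots p = concatMap (λ b → pivot b (p b))

  data Pivot (b x : ℕ) : List ℕ → Set where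
    omitted : above b → x ≡ M b → Pivot b x []
    kept    : (above b → x ≢ M b) → Pivot b x [ x ]

  pivot-view : ∀ b x → Pivot b x (pivot b x)
  pivot-view b x = view (above? b) (x ≟ M b)
    where
    view : (ab : Dec (above b)) (x≟M : Dec (x ≡ M b)) → Pivot b x (if ⌊ ab ⌋ ∧ ⌊ x≟M ⌋ then [] else [ x ])
    view (yes ab) (yes x≡M) = omitted ab x≡M
    view (yes _)  (no x≢M)  = kept (λ _ → x≢M)
    view (no ¬ab) _         = kept (λ ab → ⊥-elim (¬ab ab))

  ColumnWeak : (ℕ → ℕ) → List ℕ → Set
  ColumnWeak p = All (λ b → above b → M b ≤ p b)

  -- V still owes the nonempty word X that U has already emitted, and X ≤ B ≤ U on the remaining
  -- columns. While U emits, the debt stays nonempty; where U omits, U c = M c ≥ B, so V paying a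
  -- letter of X there would force V c = M c, which V omits. So the debt is never paid.
  pivots-lag : ∀ U V {B} cs → AllPairs (_≤_ on U) cs → ColumnWeak V cs → All ((B ≤_) ∘ U) cs →
               ∀ X → X ≢ [] → All (_≤ B) X → pivots V cs ≢ X ++ pivots U cs
  pivots-lag U V [] _ _ _ X X≢[] _ eq = X≢[] (++-conicalˡ X [] (sym eq))
  pivots-lag U V {B} (c ∷ cs) (Uc≤U ∷ U-mono) (Vc-weak ∷ V-weak) (B≤Uc ∷ B≤U) =
    step (pivot-view c (U c)) (pivot-view c (V c))
    where
    U-emits : ∀ X → All (_≤ B) X → pivots V cs ≢ X ++ U c ∷ pivots U cs
    U-emits X X≤B eq = pivots-lag U V cs U-mono V-weak Uc≤U (X ∷ʳ U c) (∷ʳ-≢-[] X)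
      (Allₚ.++⁺ (All.map (λ x≤B → ≤-trans x≤B B≤Uc) X≤B) (≤-refl ∷ []))
      (trans eq (sym (++-assoc X [ U c ] (pivots U cs))))

    step : ∀ {eU eV} → Pivot c (U c) eU → Pivot c (V c) eV →
           ∀ X → X ≢ [] → All (_≤ B) X → eV ++ pivots V cs ≢ X ++ eU ++ pivots U cs
    step (omitted _ _) (omitted _ _) X X≢[] X≤B eq = pivots-lag U V cs U-mono V-weak B≤U X X≢[] X≤B eq
    step (kept _)      (omitted _ _) X _    X≤B eq = U-emits X X≤B eq
    step _ _ [] X≢[] _ _ = X≢[] refl
    step (omitted ab Uc≡M) (kept Vc≢M) (x ∷ _) _ (x≤B ∷ _) eq =
      Vc≢M ab (≤-antisym (subst (_≤ M c) (sym (∷-injectiveˡ eq)) (≤-trans x≤B (subst (B ≤_) Uc≡M B≤Uc))) (Vc-weak ab))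
    step (kept _) (kept _) (_ ∷ X) _ (_ ∷ X≤B) eq = U-emits X X≤B (∷-injectiveʳ eq)

  pivots-injective : ∀ U V cs → AllPairs (_≤_ on U) cs → AllPairs (_≤_ on V) cs →
                     ColumnWeak U cs → ColumnWeak V cs → pivots U cs ≡ pivots V cs → All (λ b → U b ≡ V b) cs
  pivots-injective U V [] _ _ _ _ _ = []
  pivots-injective U V (c ∷ cs) (Uc≤U ∷ U-mono) (Vc≤V ∷ V-mono) (_ ∷ U-weak) (_ ∷ V-weak) =
    step (pivot-view c (U c)) (pivot-view c (V c))
    where
    rest : pivots U cs ≡ pivots V cs → All (λ b → U b ≡ V b) cs
    rest = pivots-injective U V cs U-mono V-mono U-weak V-weak

    step : ∀ {eU eV} → Pivot c (U c) eU → Pivot c (V c) eV →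
           eU ++ pivots U cs ≡ eV ++ pivots V cs → All (λ b → U b ≡ V b) (c ∷ cs)
    step (omitted _ Uc≡M) (omitted _ Vc≡M) eq = trans Uc≡M (sym Vc≡M) ∷ rest eq
    step (kept _)         (kept _)         eq = ∷-injectiveˡ eq ∷ rest (∷-injectiveʳ eq)
    step (kept _) (omitted _ _) eq =
      ⊥-elim (pivots-lag U V cs U-mono V-weak Uc≤U [ U c ] (λ ()) (≤-refl ∷ []) (sym eq))
    step (omitted _ _) (kept _) eq =
      ⊥-elim (pivots-lag V U cs V-mono U-weak Vc≤V [ V c ] (λ ()) (≤-refl ∷ []) eq)

pivots-cong : ∀ {above : Pred ℕ 0ℓ} (above? : Decidable above) {M M′ : ℕ → ℕ} →
  (∀ b → above b → M b ≡ M′ b) → ∀ p cs → Pivots.pivots above? M p cs ≡ Pivots.pivots above? M′ p cs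
pivots-cong {above} above? {M} {M′} M≡M′ p = concatMap-cong λ b → pivot≡ (above? b) (M≡M′ b)
  where
  pivot≡ : ∀ {b} (ab : Dec (above b)) → (above b → M b ≡ M′ b) →
    (if ⌊ ab ⌋ ∧ ⌊ p b ≟ M b ⌋ then [] else [ p b ]) ≡ (if ⌊ ab ⌋ ∧ ⌊ p b ≟ M′ b ⌋ then [] else [ p b ])
  pivot≡ {b} (yes ab) M≡ = cong (λ m → if ⌊ p b ≟ m ⌋ then [] else [ p b ]) (M≡ ab)
  pivot≡     (no _)   _  = refl

columns : List ℕ → List ℕ → ℕ → List ℕ
columns lam mu a = range (part mu a) (part lam a)

-- The two halves of rowWord: rowWord lam mu R a unfolds to map (_, a) (nonPivots … ++ rowPivots …).
nonPivots : List ℕ → List ℕ → Filling → ℕ → List ℕ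
nonPivots lam mu R a = concatMap (reverse ∘ drop 1 ∘ R a) (reverse (columns lam mu a))

rowPivots : List ℕ → List ℕ → Filling → ℕ → List ℕ
rowPivots lam mu R a =
  Pivots.pivots (inShape? lam mu (a ∸ 1)) (maxS ∘ R (a ∸ 1)) (minS ∘ R a) (columns lam mu a)

nonPivots-length : ∀ lam mu R a → length (nonPivots lam mu R a) ≡ ex lam mu R a
nonPivots-length lam mu R a = begin
  length (concatMap (reverse ∘ drop 1 ∘ R a) (reverse cols)) ≡⟨ cong length (concatMap-reverse (drop 1 ∘ R a) cols) ⟩
  length (reverse (concatMap (drop 1 ∘ R a) cols))          ≡⟨ length-reverse (concatMap (drop 1 ∘ R a) cols) ⟩
  length (concatMap (drop 1 ∘ R a) cols)                    ≡⟨ length-concatMap (drop 1 ∘ R a) cols ⟩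
  sum (map (length ∘ drop 1 ∘ R a) cols)                    ≡⟨ cong sum (map-cong (length-drop 1 ∘ R a) cols) ⟩
  ex lam mu R a                                             ∎
  where
  open ≡-Reasoning
  cols : List ℕ
  cols = columns lam mu a

rowWord-tagged : ∀ lam mu R → Tagged (rowWord lam mu R)
rowWord-tagged lam mu R a = Allₚ.map⁺ (All.universal (λ _ → refl) _)

part-nonzero⇒row : ∀ l a → 0 < part l a → 0 < a × a ≤ length l
part-nonzero⇒row _       zero          ()
part-nonzero⇒row []      (suc _)       ()
part-nonzero⇒row (_ ∷ _) (suc zero)    _ = s≤s z≤n , s≤s z≤n
part-nonzero⇒row (_ ∷ l) (suc (suc a)) p = s≤s z≤n , s≤s (proj₂ (part-nonzero⇒row l (suc a) p))

row-of-box : ∀ {lam mu a b} → InShape lam mu a b → a ∈ range 0 (length lam)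
row-of-box {lam} {a = a} (m<b , b≤n) =
  let 0<a , a≤N = part-nonzero⇒row lam a (<-≤-trans (≤-<-trans z≤n m<b) b≤n) in ∈-range⁺ 0<a a≤N

module _ {lam mu : List ℕ} {T : Filling} (sv : SVRPP lam mu T) where
  open SVRPP sv using (rowWeak; colWeak)

  row-max≤min : ∀ {a b d} → InShape lam mu a b → InShape lam mu a d → b < d → maxS (T a b) ≤ minS (T a d)
  row-max≤min {a} {b} {suc d} sb sd (s≤s b≤d) with m≤n⇒m<n∨m≡n b≤d
  ... | inj₂ refl = rowWeak a b sb sd
  ... | inj₁ b<d  =
    let sd′ = <-trans (proj₁ sb) b<d , <⇒≤ (proj₂ sd)
    in ≤-trans (row-max≤min sb sd′ b<d) (≤-trans (minS≤maxS (T a d)) (rowWeak a d sd′ sd))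

  row-sortedBlocks : ∀ a → SortedBlocks (T a) (columns lam mu a)
  row-sortedBlocks a = sortedBlocks
    (All.tabulate λ b∈ → SVRPP.nonempty sv a _ (∈-range⁻ b∈))
    (All.tabulate λ b∈ → SVRPP.sorted sv a _ (∈-range⁻ b∈))
    (AllPairs-range λ b∈ d∈ → row-max≤min (∈-range⁻ b∈) (∈-range⁻ d∈))

  row-columnWeak : ∀ a {M} → (∀ b → InShape lam mu a b → M b ≡ maxS (T a b)) →
    Pivots.ColumnWeak (inShape? lam mu a) M (minS ∘ T (suc a)) (columns lam mu (suc a))
  row-columnWeak a M≡ = All.tabulate λ {b} b∈ sab →
    subst (_≤ minS (T (suc a) b)) (sym (M≡ b sab)) (colWeak a b sab (∈-range⁻ b∈))

row-determined : ∀ {lam mu T T′} → SVRPP lam mu T → SVRPP lam mu T′ → ∀ a →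
  (∀ b → InShape lam mu a b → T a b ≡ T′ a b) →
  rowWord lam mu T (suc a) ≡ rowWord lam mu T′ (suc a) → ex lam mu T (suc a) ≡ ex lam mu T′ (suc a) →
  ∀ b → InShape lam mu (suc a) b → T (suc a) b ≡ T′ (suc a) b
row-determined {lam} {mu} {T} {T′} sv sv′ a above≡ rowWord≡ ex≡ b sb =
  All.lookup blocks≡ (∈-range⁺ (proj₁ sb) (proj₂ sb))
  where
  open Pivots (inShape? lam mu a) (maxS ∘ T a)
  cols : List ℕ
  cols = columns lam mu (suc a)

  letters≡ : nonPivots lam mu T (suc a) ++ rowPivots lam mu T (suc a)
           ≡ nonPivots lam mu T′ (suc a) ++ rowPivots lam mu T′ (suc a)
  letters≡ = map-injective (cong proj₁) rowWord≡

  halves≡ : nonPivots lam mu T (suc a) ≡ nonPivots lam mu T′ (suc a)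
          × rowPivots lam mu T (suc a) ≡ rowPivots lam mu T′ (suc a)
  halves≡ = ++-injective-length (nonPivots lam mu T (suc a)) (nonPivots lam mu T′ (suc a))
              (trans (nonPivots-length lam mu T (suc a)) (trans ex≡ (sym (nonPivots-length lam mu T′ (suc a)))))
              letters≡

  pivots≡ : pivots (minS ∘ T (suc a)) cols ≡ pivots (minS ∘ T′ (suc a)) cols
  pivots≡ = trans (proj₂ halves≡)
    (pivots-cong (inShape? lam mu a) (λ b sab → sym (cong maxS (above≡ b sab))) (minS ∘ T′ (suc a)) cols)

  mins≡ : All (λ b → minS (T (suc a) b) ≡ minS (T′ (suc a) b)) cols
  mins≡ = pivots-injective _ _ cols
    (minS-ascending (row-sortedBlocks sv (suc a))) (minS-ascending (row-sortedBlocks sv′ (suc a)))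
    (row-columnWeak sv a (λ _ _ → refl)) (row-columnWeak sv′ a (λ b sab → cong maxS (above≡ b sab)))
    pivots≡

  tails≡ : concatMap (drop 1 ∘ T (suc a)) cols ≡ concatMap (drop 1 ∘ T′ (suc a)) cols
  tails≡ = reverse-injective (begin
    reverse (concatMap (drop 1 ∘ T (suc a)) cols)  ≡⟨ concatMap-reverse (drop 1 ∘ T (suc a)) cols ⟨
    nonPivots lam mu T (suc a)                     ≡⟨ proj₁ halves≡ ⟩
    nonPivots lam mu T′ (suc a)                    ≡⟨ concatMap-reverse (drop 1 ∘ T′ (suc a)) cols ⟩
    reverse (concatMap (drop 1 ∘ T′ (suc a)) cols) ∎)
    where open ≡-Reasoning

  blocks≡ : All (λ b → T (suc a) b ≡ T′ (suc a) b) cols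
  blocks≡ = blocks-injective (row-sortedBlocks sv (suc a)) (row-sortedBlocks sv′ (suc a)) mins≡ tails≡

proposition3p12 : (lam mu : List ℕ) → IsPartition lam → IsPartition mu → Contained mu lam →
    (w h : List ℕ) (α : ℕ → ℕ) (T T′ : Filling) →
    SVRPP lam mu T → read lam mu T ≡ w → height lam mu T ≡ h → (∀ a → ex lam mu T a ≡ α a) →
    SVRPP lam mu T′ → read lam mu T′ ≡ w → height lam mu T′ ≡ h → (∀ a → ex lam mu T′ a ≡ α a) →
    ∀ a b → InShape lam mu a b → T a b ≡ T′ a b
-- The argument never uses that λ and μ are partitions with μ ⊆ λ.
proposition3p12 lam mu _ _ _ _ _ _ T T′ sv refl refl ex≡α sv′ read≡ height≡ ex′≡α = agree
  where
  rowWords≡ : All (λ a → rowWord lam mu T a ≡ rowWord lam mu T′ a) (reverse (range 0 (length lam)))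
  rowWords≡ = concatMap-injective-tagged (rowWord-tagged lam mu T) (rowWord-tagged lam mu T′)
    (reverse-range-unique (length lam)) (map-proj-injective (sym read≡) (sym height≡))

  agree : ∀ a b → InShape lam mu a b → T a b ≡ T′ a b
  agree zero    _ (0<b , b≤0) = ⊥-elim (<⇒≱ 0<b b≤0)
  agree (suc a) b sb =
    row-determined sv sv′ a (agree a) (All.lookup rowWords≡ (reverse⁺ (row-of-box {lam} {mu} sb)))
      (trans (ex≡α (suc a)) (sym (ex′≡α (suc a)))) b sb
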